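{- Let $T$ be a finite tree rooted at $r$. Consider the recursive procedure $\mathrm{Assign}(u,t)$ (for a node $u$ and an integer $t$) which does the following: (1) set $a(u), \overline{a}(u), b(u), \overline{b}(u)$ all equal to $t$; (2) for each child $v$ of $u$, in some order, call $\mathrm{Assign}(v, \overline{b}(u)+1)$ (using the current value of $\overline{b}(u)$) and then set $\overline{a}(u) \gets \overline{a}(v)$ and $\overline{b}(u) \gets \overline{b}(v)$; (3) after all children are processed, set $b(u)$ to some integer with $b(u) \ge \overline{a}(u)$ (current value of $\overline{a}(u)$); (4) set $\overline{b}(u) \gets \max\{b(u), \overline{b}(u)\}$. Here the order in which the children are processed in step (2) and the choice of $b(u)$ in step (3) are arbitrary (subject only to $b(u)\ge\overline{a}(u)$). Then after running $\mathrm{Assign}(r,0)$, the interval assignment $u \mapsto I(u) = [a(u), b(u)]$ on $V(T)$ is left-including, i.e. for all nodes $u,v$ of $T$, $u$ is an ancestor of $v$ if and only if $a(v) \in [a(u), b(u)]$.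
   Context: In a rooted tree, $u$ is an ancestor of $v$ if $u$ lies on the unique path from the root to $v$; every node is an ancestor (and a descendant) of itself. $[x,y]$ denotes the closed interval $\{z : x \le z \le y\}$. -}

module Defs where

open import Data.List using (List; []; _∷_; length; lookup)
open import Data.Fin using (Fin)
open import Data.Integer using (ℤ; _+_; _≤_; _⊔_; 1ℤ)

-- A finite rooted tree; the list of subtrees is the ordered list of children.
-- (Every ordering of the children of a finite rooted tree is such a rose tree,
-- so quantifying over all rose trees covers every processing order in step (2).)
data Tree : Set where
  node : List Tree → Tree

-- The output of the procedure: the same tree with each node u labelled by (a(u), b(u)).
data LTree : Set where
  lnode : (a b : ℤ) → List LTree → LTree

-- Big-step semantics of Assign(u, t).
-- Assign t T L ā b̄ : running Assign(root of T, t) may produce the labelled tree L,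
-- with final values ā (= ā(root)) and b̄ (= b̄(root)).
-- AssignKids ā b̄ cs ls ā' b̄' : step (2) processing the children cs (in list order)
-- starting from current values ā, b̄ of the parent and ending with ā', b̄'.
mutual
  data Assign : ℤ → Tree → LTree → ℤ → ℤ → Set where
    assign : ∀ {t cs ls ā b̄} (b : ℤ) →
             AssignKids t t cs ls ā b̄ →       -- steps (1),(2)
             ā ≤ b →                           -- step (3): arbitrary b(u) ≥ ā(u)
             Assign t (node cs) (lnode t b ls) ā (b ⊔ b̄)   -- step (4)

  data AssignKids : ℤ → ℤ → List Tree → List LTree → ℤ → ℤ → Set where
    kids-[] : ∀ {ā b̄} → AssignKids ā b̄ [] [] ā b̄
    kids-∷  : ∀ {ā b̄ c cs l ls ā₁ b̄₁ ā₂ b̄₂} →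
              Assign (b̄ + 1ℤ) c l ā₁ b̄₁ →       -- Assign(v, b̄(u)+1)
              AssignKids ā₁ b̄₁ cs ls ā₂ b̄₂ →     -- ā(u) ← ā(v), b̄(u) ← b̄(v)
              AssignKids ā b̄ (c ∷ cs) (l ∷ ls) ā₂ b̄₂

-- Nodes of a labelled tree: paths from the root.
data Pos : LTree → Set where
  here  : ∀ {a b ls} → Pos (lnode a b ls)
  there : ∀ {a b ls} (i : Fin (length ls)) → Pos (lookup ls i) → Pos (lnode a b ls)

-- u ≼ v : u is an ancestor of v (reflexive).
data _≼_ : ∀ {L} → Pos L → Pos L → Set where
  here≼  : ∀ {a b ls} {q : Pos (lnode a b ls)} → here ≼ q
  there≼ : ∀ {a b ls} {i : Fin (length ls)} {p q : Pos (lookup ls i)} →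
           p ≼ q → there {a} {b} {ls} i p ≼ there {a} {b} {ls} i q

aOf : ∀ {L} → Pos L → ℤ
aOf (here {a}) = a
aOf (there i p) = aOf p

bOf : ∀ {L} → Pos L → ℤ
bOf (here {b = b}) = b
bOf (there i p) = bOf p

_∈I_ : ℤ → ∀ {L} → Pos L → Set
z ∈I u = (aOf u ≤ z) Data.Product.× (z ≤ bOf u)
  where import Data.Product

module Submission where

-- A run of Assign(u, t) stamps every node of the subtree of u
-- with numbers between t and the final value ā(u): a(x) ∈ [t, ā(u)] and
-- b(x) ≤ b̄(u), while t ≤ ā(u) ≤ b̄(u) (lemma assign-bounds, proved together
-- with its counterpart kids-bounds for the loop over the children).  Since
-- child number k+1 starts at b̄ + 1 where b̄ is the value left behind by child
-- number k, the subtrees of the children occupy disjoint, increasing ranges: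
-- every label of an earlier child is strictly below every a-label of a later
-- one (siblings-separated), and every a-label below u lies strictly above
-- a(u) (descendants-above-root).  Both directions of the theorem then follow
-- by induction along positions, using that every child subtree is again the
-- outcome of a run of Assign (children-assigned):
--   * ancestor ⇒ interval: the root's interval [t, b(u)] covers all a-labels
--     of its subtree (root-covers);
--   * interval ⇒ ancestor: a node is never in the interval of a proper
--     descendant or of a node in a different sibling subtree.

open import Defs
open import Data.Integer using (ℤ; 0ℤ; _+_; _≤_; _<_; 1ℤ)
open import Data.Integer.Properties
  using ( ≤-refl; ≤-reflexive; ≤-trans; ≤-<-trans; <⇒≤; ≤⇒≯; +-comm; +-monoˡ-≤
        ; suc[i]≤j⇒i<j; i≤i⊔j; i≤j⇒i≤j⊔k; i≤j⇒i≤k⊔j )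
open import Data.Empty using (⊥-elim)
open import Data.Fin using (Fin; zero; suc) renaming (_<_ to _<ᶠ_)
open import Data.Fin.Properties using (<-cmp)
open import Data.List using (_∷_; length; lookup)
open import Data.Nat using (s≤s)
open import Data.Product using (_×_; _,_; proj₁; proj₂; ∃-syntax)
open import Function.Bundles using (_⇔_; mk⇔)
open import Relation.Binary.Definitions using (tri<; tri≈; tri>)
open import Relation.Binary.PropositionalEquality using (refl)
open import Relation.Nullary using (¬_)

+1≤⇒< : ∀ {i j} → i + 1ℤ ≤ j → i < j
+1≤⇒< {i} i+1≤j = suc[i]≤j⇒i<j (≤-trans (≤-reflexive (+-comm 1ℤ i)) i+1≤j)

i≤i+1 : ∀ i → i ≤ i + 1ℤ
i≤i+1 i = <⇒≤ (+1≤⇒< {i} ≤-refl)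

below-∉I : ∀ {L} {z} (u : Pos L) → z < aOf u → ¬ (z ∈I u)
below-∉I u z<a (a≤z , _) = ≤⇒≯ a≤z z<a

above-∉I : ∀ {L} {z} (u : Pos L) → bOf u < z → ¬ (z ∈I u)
above-∉I u b<z (_ , z≤b) = ≤⇒≯ z≤b b<z

record Bounded (lo ā b̄ : ℤ) (L : LTree) : Set where
  field
    a-lower : (x : Pos L) → lo ≤ aOf x
    a-upper : (x : Pos L) → aOf x ≤ ā
    b-upper : (x : Pos L) → bOf x ≤ b̄
open Bounded

weaken : ∀ {lo lo′ ā ā′ b̄ b̄′ L} → lo′ ≤ lo → ā ≤ ā′ → b̄ ≤ b̄′ →
         Bounded lo ā b̄ L → Bounded lo′ ā′ b̄′ L
weaken lo′≤lo ā≤ā′ b̄≤b̄′ B = record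
  { a-lower = λ x → ≤-trans lo′≤lo (a-lower B x)
  ; a-upper = λ x → ≤-trans (a-upper B x) ā≤ā′
  ; b-upper = λ x → ≤-trans (b-upper B x) b̄≤b̄′ }

bounded-node : ∀ {lo ā b̄ a b ls} → lo ≤ a → a ≤ ā → b ≤ b̄ →
               ((i : Fin (length ls)) → Bounded lo ā b̄ (lookup ls i)) →
               Bounded lo ā b̄ (lnode a b ls)
bounded-node lo≤a a≤ā b≤b̄ kids = record
  { a-lower = λ { here → lo≤a ; (there i x) → a-lower (kids i) x }
  ; a-upper = λ { here → a≤ā ; (there i x) → a-upper (kids i) x }
  ; b-upper = λ { here → b≤b̄ ; (there i x) → b-upper (kids i) x } }

mutual
  assign-bounds : ∀ {t T L ā b̄} → Assign t T L ā b̄ →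
                  t ≤ ā × ā ≤ b̄ × Bounded t ā b̄ L
  assign-bounds {t} (assign {b̄ = b̄ₖ} b K ā≤b) with kids-bounds K ≤-refl
  ... | t≤ā , _ , _ , kids =
    t≤ā , i≤j⇒i≤j⊔k b̄ₖ ā≤b ,
    bounded-node ≤-refl t≤ā (i≤i⊔j b b̄ₖ)
      (λ i → weaken (i≤i+1 t) ≤-refl (i≤j⇒i≤k⊔j b ≤-refl) (kids i))

  kids-bounds : ∀ {ā₀ b̄₀ cs ls ā b̄} → AssignKids ā₀ b̄₀ cs ls ā b̄ → ā₀ ≤ b̄₀ →
                ā₀ ≤ ā × ā ≤ b̄ × b̄₀ ≤ b̄ ×
                ((i : Fin (length ls)) → Bounded (b̄₀ + 1ℤ) ā b̄ (lookup ls i))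
  kids-bounds kids-[] ā₀≤b̄₀ = ≤-refl , ā₀≤b̄₀ , ≤-refl , λ ()
  kids-bounds {b̄₀ = b̄₀} {ls = l ∷ ls} {ā} {b̄} (kids-∷ {ā₁ = ā₁} {b̄₁} D R) ā₀≤b̄₀
    with assign-bounds D
  ... | b̄₀+1≤ā₁ , ā₁≤b̄₁ , first
    with kids-bounds R ā₁≤b̄₁
  ... | ā₁≤ā , ā≤b̄ , b̄₁≤b̄ , rest =
    ≤-trans ā₀≤b̄₀ (≤-trans b̄₀≤ā₁ ā₁≤ā) , ā≤b̄ ,
    ≤-trans b̄₀≤ā₁ (≤-trans ā₁≤b̄₁ b̄₁≤b̄) , kids
    where
    b̄₀≤ā₁ : b̄₀ ≤ ā₁
    b̄₀≤ā₁ = ≤-trans (i≤i+1 b̄₀) b̄₀+1≤ā₁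

    kids : (i : Fin (length (l ∷ ls))) → Bounded (b̄₀ + 1ℤ) ā b̄ (lookup (l ∷ ls) i)
    kids zero    = weaken ≤-refl ā₁≤ā b̄₁≤b̄ first
    kids (suc i) = weaken (+-monoˡ-≤ 1ℤ (≤-trans b̄₀≤ā₁ ā₁≤b̄₁)) ≤-refl ≤-refl (rest i)

siblings-separated : ∀ {ā₀ b̄₀ cs ls ā b̄} → AssignKids ā₀ b̄₀ cs ls ā b̄ →
                     {i j : Fin (length ls)} → i <ᶠ j →
                     (x : Pos (lookup ls i)) (y : Pos (lookup ls j)) →
                     aOf x < aOf y × bOf x < aOf y
siblings-separated (kids-∷ {ā₁ = ā₁} {b̄₁} D R) {zero} {suc j} _ x y
  with assign-bounds D
... | _ , ā₁≤b̄₁ , first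
  with kids-bounds R ā₁≤b̄₁
... | _ , _ , _ , rest =
  ≤-<-trans (≤-trans (a-upper first x) ā₁≤b̄₁) b̄₁<y , ≤-<-trans (b-upper first x) b̄₁<y
  where
  b̄₁<y : b̄₁ < aOf y
  b̄₁<y = +1≤⇒< (a-lower (rest j) y)
siblings-separated (kids-∷ D R) {suc i} {suc j} (s≤s i<j) x y =
  siblings-separated R i<j x y

descendants-above-root : ∀ {t cs a b ls ā b̄} → Assign t (node cs) (lnode a b ls) ā b̄ →
                         (i : Fin (length ls)) (x : Pos (lookup ls i)) → a < aOf x
descendants-above-root (assign _ K _) i x with kids-bounds K ≤-refl
... | _ , _ , _ , kids = +1≤⇒< (a-lower (kids i) x)

root-covers : ∀ {t T a b ls ā b̄} → Assign t T (lnode a b ls) ā b̄ →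
              (x : Pos (lnode a b ls)) → aOf x ∈I here {a} {b} {ls}
root-covers D@(assign _ _ ā≤b) x with assign-bounds D
... | _ , _ , B = a-lower B x , ≤-trans (a-upper B x) ā≤b

Assigned : LTree → Set
Assigned L = ∃[ t ] ∃[ T ] ∃[ ā ] ∃[ b̄ ] Assign t T L ā b̄

kids-assigned : ∀ {ā₀ b̄₀ cs ls ā b̄} → AssignKids ā₀ b̄₀ cs ls ā b̄ →
                (i : Fin (length ls)) → Assigned (lookup ls i)
kids-assigned (kids-∷ D _) zero    = _ , _ , _ , _ , D
kids-assigned (kids-∷ _ R) (suc i) = kids-assigned R i

children-assigned : ∀ {a b ls} → Assigned (lnode a b ls) →
                    (i : Fin (length ls)) → Assigned (lookup ls i)
children-assigned (_ , _ , _ , _ , assign _ K _) = kids-assigned K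

ancestor⇒interval : ∀ {L} → Assigned L → {u v : Pos L} → u ≼ v → aOf v ∈I u
ancestor⇒interval (_ , _ , _ , _ , D@(assign _ _ _)) {v = v} here≼ = root-covers D v
ancestor⇒interval A (there≼ {i = i} u≼v) = ancestor⇒interval (children-assigned A i) u≼v

interval⇒ancestor : ∀ {L} → Assigned L → (u v : Pos L) → aOf v ∈I u → u ≼ v
interval⇒ancestor A here v _ = here≼
interval⇒ancestor (_ , _ , _ , _ , D@(assign _ _ _)) (there i x) here root∈x =
  ⊥-elim (below-∉I x (descendants-above-root D i x) root∈x)
interval⇒ancestor A@(_ , _ , _ , _ , assign _ K _) (there i x) (there j y) y∈x
  with <-cmp i j
... | tri< i<j _ _ = ⊥-elim (above-∉I x (proj₂ (siblings-separated K i<j x y)) y∈x)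
... | tri≈ _ refl _ = there≼ (interval⇒ancestor (children-assigned A i) x y y∈x)
... | tri> _ _ j<i = ⊥-elim (below-∉I x (proj₁ (siblings-separated K j<i y x)) y∈x)

theorem1 : (T : Tree) (L : LTree) (ā b̄ : ℤ) → Assign 0ℤ T L ā b̄ →
    (u v : Pos L) → (u ≼ v) ⇔ (aOf v ∈I u)
theorem1 T L ā b̄ D u v = mk⇔ (ancestor⇒interval run) (interval⇒ancestor run u v)
  where
  run : Assigned L
  run = 0ℤ , T , ā , b̄ , D
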